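{- For every graph $G$ and all positive integers $n,k$, $$P_\ell(G,k-n)\,P(K_n,k)\le P_\ell(G\vee K_n,k)\le P(G\vee K_n,k)=P(G,k-n)\,P(K_n,k).$$ In particular, if $P_\ell(G,m)=P(G,m)$ for all positive integers $m$, then $P_\ell(G\vee K_n,k)=P(G\vee K_n,k)$ for all positive integers $k$.
   Context: $P(G,k)$ is the chromatic polynomial of $G$. For a list assignment $L$, $P(G,L)$ is the number of proper colorings $f$ of $G$ with $f(v)\in L(v)$ for all $v$. The list color function $P_\ell(G,k)$ is the minimum of $P(G,L)$ over all assignments $L$ of lists of size $k$; by convention $P_\ell(G,k)=0$ for $k<0$. $G\vee K_n$ is the join of $G$ with the complete graph $K_n$. -}

module Defs where

open import Data.Nat using (ℕ; zero; suc; _+_; _*_; _∸_; _≤_)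
open import Data.Bool using (Bool; true; false)
open import Data.Fin using (Fin; zero; suc; splitAt)
open import Data.Fin.Properties using (all?)
import Data.Fin.Properties as FinP
open import Data.Sum using (inj₁; inj₂)
open import Data.Product using (Σ; _×_; _,_)
open import Data.Vec.Functional using (_∷_)
open import Function.Definitions using (Injective)
open import Relation.Nullary using (Dec; yes; no; ¬_; does)
open import Relation.Nullary.Decidable using (_→-dec_; ¬?)
open import Relation.Binary using (DecidableEquality)
open import Relation.Binary.PropositionalEquality using (_≡_; _≢_)
open import Data.Bool.Properties using () renaming (_≟_ to _≟ᵇ_)
import Data.Nat.Properties as ℕP

record Graph : Set where
  field
    size  : ℕ
    adj   : Fin size → Fin size → Bool
    sym   : ∀ u v → adj u v ≡ adj v u
    irrfl : ∀ u → adj u u ≡ false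
open Graph public

Proper : (G : Graph) {C : Set} → (Fin (size G) → C) → Set
Proper G f = ∀ u v → adj G u v ≡ true → f u ≢ f v

proper? : (G : Graph) {C : Set} → DecidableEquality C →
          (f : Fin (size G) → C) → Dec (Proper G f)
proper? G _≟_ f = all? λ u → all? λ v →
  (adj G u v ≟ᵇ true) →-dec ¬? (f u ≟ f v)

sumFin : (k : ℕ) → (Fin k → ℕ) → ℕ
sumFin zero    g = 0
sumFin (suc k) g = g zero + sumFin k (λ i → g (suc i))

count : (v k : ℕ) {P : (Fin v → Fin k) → Set} → (∀ f → Dec (P f)) → ℕ
count zero    k P? with does (P? (λ ()))
... | true  = 1
... | false = 0
count (suc v) k P? = sumFin k (λ c → count v k (λ f → P? (c ∷ f)))

-- Chromatic polynomial evaluated at a natural number k: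
-- the number of proper colourings of G with colours from Fin k.
P : Graph → ℕ → ℕ
P G k = count (size G) k (proper? G FinP._≟_)

-- A k-list assignment: each vertex v gets a list L(v) of exactly k distinct
-- colours (natural numbers), given as an injective enumeration Fin k → ℕ.
ListAssignment : Graph → ℕ → Set
ListAssignment G k = Σ (Fin (size G) → Fin k → ℕ) λ L → ∀ v → Injective _≡_ _≡_ (L v)

-- P(G,L): number of proper colourings f with f(v) ∈ L(v) for all v.
-- Such colourings correspond bijectively (L(v) injective) to choices of an
-- index i_v ∈ Fin k for each v, with colour L v i_v.
PL : (G : Graph) {k : ℕ} → ListAssignment G k → ℕ
PL G {k} (L , _) = count (size G) k (λ i → proper? G ℕP._≟_ (λ v → L v (i v)))

IsListColorFunction : Graph → ℕ → ℕ → Set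
IsListColorFunction G k m =
  Σ (ListAssignment G k) (λ L → PL G L ≡ m) × (∀ (L : ListAssignment G k) → m ≤ PL G L)

K : ℕ → Graph
K n = record { size = n ; adj = adjK ; sym = symK ; irrfl = irrK }
  where
  adjK : Fin n → Fin n → Bool
  adjK u v = Data.Bool.not (does (u FinP.≟ v))
  symK : ∀ u v → adjK u v ≡ adjK v u
  symK u v with u FinP.≟ v | v FinP.≟ u
  ... | yes _ | yes _ = Relation.Binary.PropositionalEquality.refl
  ... | no _  | no _  = Relation.Binary.PropositionalEquality.refl
  ... | yes p | no q  = Data.Empty.⊥-elim (q (Relation.Binary.PropositionalEquality.sym p))
    where import Data.Empty
  ... | no p  | yes q = Data.Empty.⊥-elim (p (Relation.Binary.PropositionalEquality.sym q))
    where import Data.Empty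
  irrK : ∀ u → adjK u u ≡ false
  irrK u with u FinP.≟ u
  ... | yes _ = Relation.Binary.PropositionalEquality.refl
  ... | no p  = Data.Empty.⊥-elim (p Relation.Binary.PropositionalEquality.refl)
    where import Data.Empty

-- Join G ∨ H: disjoint union plus all edges between V(G) and V(H).
-- Vertices Fin (size G + size H); the first size G are G's.
_∨_ : Graph → Graph → Graph
G ∨ H = record { size = size G + size H ; adj = a ; sym = s ; irrfl = i }
  where
  a : Fin (size G + size H) → Fin (size G + size H) → Bool
  a u v with splitAt (size G) u | splitAt (size G) v
  ... | inj₁ x | inj₁ y = adj G x y
  ... | inj₂ x | inj₂ y = adj H x y
  ... | inj₁ _ | inj₂ _ = true
  ... | inj₂ _ | inj₁ _ = true
  s : ∀ u v → a u v ≡ a v u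
  s u v with splitAt (size G) u | splitAt (size G) v
  ... | inj₁ x | inj₁ y = sym G x y
  ... | inj₂ x | inj₂ y = sym H x y
  ... | inj₁ _ | inj₂ _ = Relation.Binary.PropositionalEquality.refl
  ... | inj₂ _ | inj₁ _ = Relation.Binary.PropositionalEquality.refl
  i : ∀ u → a u u ≡ false
  i u with splitAt (size G) u
  ... | inj₁ x = irrfl G x
  ... | inj₂ x = irrfl H x

-- A colouring of G ∨ Kₙ is a pair (f , h) of colourings of G and of Kₙ; it is proper iff f and h
-- are proper and f avoids the colours of h, which are pairwise distinct because Kₙ is complete.
-- Counting colourings as sums of indicators over all choices of list indices, the number of proper
-- L-colourings of G ∨ Kₙ is Σₕ [h proper] · #{proper f avoiding the colours of h}.  Deleting from
-- every list of G one entry per avoided colour (that colour if present, an arbitrary entry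
-- otherwise) leaves lists of size k − n, so the inner count is at least P_ℓ(G, k − n), and the
-- outer sum is P(Kₙ, L) ≥ P(Kₙ, k) by the same argument for a vertex joined to Kₙ₋₁.  For the
-- lists {0, …, k − 1} the avoided colours are deleted exactly, which gives the product formula.

module Submission where

open import Defs hiding (sym)
open import Data.Nat using (ℕ; zero; suc; _+_; _*_; _∸_; _≤_; z≤n; s≤s; _≟_)
open import Data.Nat.Properties
  using ( +-*-semiring; +-mono-≤; *-monoʳ-≤; *-comm; *-identityʳ; *-identityˡ; *-zeroʳ
        ; m≤n+m; ≤-reflexive; ≤-trans; module ≤-Reasoning)
open import Algebra.Properties.Semiring.Sum +-*-semiring
  using (sum; sum-cong-≗; ∑-comm; sum-remove; *-distribˡ-sum)
open import Data.Bool using (true; not; if_then_else_)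
open import Data.Fin using (Fin; zero; suc; toℕ; punchIn; punchOut; splitAt; _↑ˡ_; _↑ʳ_)
import Data.Fin.Properties as Fin
open import Data.Fin.Properties using (toℕ-injective)
open import Data.Product using (_×_; _,_; proj₁; proj₂; ∃-syntax)
open import Data.Sum using (_⊎_; inj₁; inj₂)
open import Data.Vec.Functional using (_∷_; _++_; removeAt)
open import Data.Vec.Functional.Properties using (∷-cong; lookup-++ˡ; lookup-++ʳ)
open import Data.Empty using (⊥-elim)
open import Data.List using (List; []; length; tabulate) renaming (_∷_ to _∷ₗ_)
open import Data.List.Relation.Unary.All as All using (All)
import Data.List.Relation.Unary.AllPairs as AllPairs
open import Data.List.Relation.Unary.Unique.Propositional using (Unique)
import Data.List.Relation.Unary.All.Properties as AllP
import Data.List.Relation.Unary.Unique.Propositional.Properties as UniqueP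
open import Data.List.Properties using (length-tabulate)
open import Function using (_∘_; _⇔_; mk⇔)
open import Function.Definitions using (Injective; Congruent)
open import Relation.Nullary using (Dec; yes; no; does; ¬_)
open import Relation.Nullary.Decidable using (¬?; _×-dec_; does-⇔; dec-true; dec-false)
open import Relation.Binary.PropositionalEquality
  using (_≡_; _≢_; _≗_; refl; sym; trans; cong; cong₂; subst)

sum-mono-≤ : ∀ {k} {f g : Fin k → ℕ} → (∀ i → f i ≤ g i) → sum f ≤ sum g
sum-mono-≤ {zero}  f≤g = z≤n
sum-mono-≤ {suc k} f≤g = +-mono-≤ (f≤g zero) (sum-mono-≤ (f≤g ∘ suc))

sumFin≡sum : ∀ k (g : Fin k → ℕ) → sumFin k g ≡ sum g
sumFin≡sum zero    g = refl
sumFin≡sum (suc k) g = cong (g zero +_) (sumFin≡sum k (g ∘ suc))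

sumMaps : (v k : ℕ) → ((Fin v → Fin k) → ℕ) → ℕ
sumMaps zero    k w = w (λ ())
sumMaps (suc v) k w = sum λ c → sumMaps v k (λ f → w (c ∷ f))

module _ {k : ℕ} where

  sumMaps-cong : ∀ v {w w′ : (Fin v → Fin k) → ℕ} → (∀ f → w f ≡ w′ f) →
    sumMaps v k w ≡ sumMaps v k w′
  sumMaps-cong zero    w≗w′ = w≗w′ _
  sumMaps-cong (suc v) w≗w′ = sum-cong-≗ λ c → sumMaps-cong v (w≗w′ ∘ (c ∷_))

  sumMaps-mono-≤ : ∀ v {w w′ : (Fin v → Fin k) → ℕ} → (∀ f → w f ≤ w′ f) →
    sumMaps v k w ≤ sumMaps v k w′
  sumMaps-mono-≤ zero    w≤w′ = w≤w′ _
  sumMaps-mono-≤ (suc v) w≤w′ = sum-mono-≤ λ c → sumMaps-mono-≤ v (w≤w′ ∘ (c ∷_))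

  *-distribˡ-sumMaps : ∀ v x (w : (Fin v → Fin k) → ℕ) → x * sumMaps v k w ≡ sumMaps v k (λ f → x * w f)
  *-distribˡ-sumMaps zero    x w = refl
  *-distribˡ-sumMaps (suc v) x w =
    trans (*-distribˡ-sum {k} x _) (sum-cong-≗ λ c → *-distribˡ-sumMaps v x (λ f → w (c ∷ f)))

  sumMaps-sum : ∀ v {m} (w : Fin m → (Fin v → Fin k) → ℕ) →
    sumMaps v k (λ f → sum λ j → w j f) ≡ sum λ j → sumMaps v k (w j)
  sumMaps-sum zero    w = refl
  sumMaps-sum (suc v) {m} w =
    trans (sum-cong-≗ λ c → sumMaps-sum v (λ j f → w j (c ∷ f))) (∑-comm {k} {m} _)

  sumMaps-comm : ∀ a b (w : (Fin a → Fin k) → (Fin b → Fin k) → ℕ) →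
    sumMaps a k (λ f → sumMaps b k (w f)) ≡ sumMaps b k (λ h → sumMaps a k λ f → w f h)
  sumMaps-comm zero    b w = refl
  sumMaps-comm (suc a) b w =
    trans (sum-cong-≗ λ c → sumMaps-comm a b (w ∘ (c ∷_)))
          (sym (sumMaps-sum b λ c h → sumMaps a k λ f → w (c ∷ f) h))

  sumMaps-++ : ∀ a b (w : (Fin (a + b) → Fin k) → ℕ) → Congruent _≗_ _≡_ w →
    sumMaps (a + b) k w ≡ sumMaps a k (λ f → sumMaps b k (λ h → w (f ++ h)))
  sumMaps-++ zero    b w w-cong = sumMaps-cong b λ h → w-cong λ _ → refl
  sumMaps-++ (suc a) b w w-cong = sum-cong-≗ λ c →
    trans (sumMaps-++ a b (w ∘ (c ∷_)) (w-cong ∘ ∷-cong refl))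
          (sumMaps-cong a λ f → sumMaps-cong b λ h → w-cong (∷-++ c f h))
    where
    ∷-++ : ∀ {A : Set} {a b} (c : A) (f : Fin a → A) (h : Fin b → A) → (c ∷ (f ++ h)) ≗ ((c ∷ f) ++ h)
    ∷-++     c f h zero = refl
    ∷-++ {a = a} c f h (suc x) with splitAt a x
    ... | inj₁ _ = refl
    ... | inj₂ _ = refl

  sumMaps-zero : ∀ v {w : (Fin v → Fin k) → ℕ} → (∀ f → w f ≡ 0) → sumMaps v k w ≡ 0
  sumMaps-zero v {w} w≡0 = trans (sumMaps-cong v w≡0) (sym (*-distribˡ-sumMaps v 0 w))

punchIns : ∀ {v k} → (Fin v → Fin (suc k)) → (Fin v → Fin k) → Fin v → Fin (suc k)
punchIns p f u = punchIn (p u) (f u)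

module _ {k : ℕ} where
  open ≤-Reasoning

  private
    punchIns-∷ : ∀ {v} (p : Fin (suc v) → Fin (suc k)) c f →
      punchIns p (c ∷ f) ≗ punchIn (p zero) c ∷ punchIns (p ∘ suc) f
    punchIns-∷ p c f = ∷-cong refl λ _ → refl

  sumMaps-punchIns-≤ : ∀ v (p : Fin v → Fin (suc k)) (w : (Fin v → Fin (suc k)) → ℕ) →
    Congruent _≗_ _≡_ w → sumMaps v k (w ∘ punchIns p) ≤ sumMaps v (suc k) w
  sumMaps-punchIns-≤ zero    p w w-cong = ≤-reflexive (w-cong λ ())
  sumMaps-punchIns-≤ (suc v) p w w-cong = begin
    sum (λ c → sumMaps v k (λ f → w (punchIns p (c ∷ f))))
      ≡⟨ sum-cong-≗ (λ c → sumMaps-cong v λ f → w-cong (punchIns-∷ p c f)) ⟩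
    sum (λ c → sumMaps v k (λ f → w (punchIn (p zero) c ∷ punchIns (p ∘ suc) f)))
      ≤⟨ sum-mono-≤ (λ c → sumMaps-punchIns-≤ v (p ∘ suc) (w ∘ (punchIn (p zero) c ∷_))
                                                (w-cong ∘ ∷-cong refl)) ⟩
    sum (removeAt t (p zero))
      ≤⟨ m≤n+m _ (t (p zero)) ⟩
    t (p zero) + sum (removeAt t (p zero))
      ≡⟨ sum-remove t ⟨
    sum t ∎
    where t = λ d → sumMaps v (suc k) (λ g → w (d ∷ g))

  sumMaps-punchIns : ∀ v (p : Fin v → Fin (suc k)) (w : (Fin v → Fin (suc k)) → ℕ) →
    Congruent _≗_ _≡_ w → (∀ g u → g u ≡ p u → w g ≡ 0) →
    sumMaps v k (w ∘ punchIns p) ≡ sumMaps v (suc k) w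
  sumMaps-punchIns zero    p w w-cong w-hit = w-cong λ ()
  sumMaps-punchIns (suc v) p w w-cong w-hit = begin-equality
    sum (λ c → sumMaps v k (λ f → w (punchIns p (c ∷ f))))
      ≡⟨ sum-cong-≗ (λ c → sumMaps-cong v λ f → w-cong (punchIns-∷ p c f)) ⟩
    sum (λ c → sumMaps v k (λ f → w (punchIn (p zero) c ∷ punchIns (p ∘ suc) f)))
      ≡⟨ sum-cong-≗ (λ c → sumMaps-punchIns v (p ∘ suc) (w ∘ (punchIn (p zero) c ∷_))
                                 (w-cong ∘ ∷-cong refl) (λ g u → w-hit _ (suc u))) ⟩
    sum (removeAt t (p zero))
      ≡⟨ cong (_+ sum (removeAt t (p zero))) (sumMaps-zero v λ g → w-hit (p zero ∷ g) zero refl) ⟨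
    t (p zero) + sum (removeAt t (p zero))
      ≡⟨ sum-remove t ⟨
    sum t ∎
    where t = λ d → sumMaps v (suc k) (λ g → w (d ∷ g))

χ : {A : Set} → Dec A → ℕ
χ d = if does d then 1 else 0

module _ {A : Set} where

  χ-yes : (d : Dec A) → A → χ d ≡ 1
  χ-yes d a = cong (if_then 1 else 0) (dec-true d a)

  χ-no : (d : Dec A) → ¬ A → χ d ≡ 0
  χ-no d ¬a = cong (if_then 1 else 0) (dec-false d ¬a)

  χ-cong : ∀ {B : Set} → A ⇔ B → (d : Dec A) (e : Dec B) → χ d ≡ χ e
  χ-cong A⇔B d e = cong (if_then 1 else 0) (does-⇔ A⇔B d e)

  χ-×-dec : ∀ {B : Set} (d : Dec A) (e : Dec B) → χ (d ×-dec e) ≡ χ d * χ e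
  χ-×-dec (yes _) (yes _) = refl
  χ-×-dec (yes _) (no _)  = refl
  χ-×-dec (no _)  _       = refl

  χ-*-cong : (d : Dec A) {x y : ℕ} → (A → x ≡ y) → χ d * x ≡ χ d * y
  χ-*-cong (yes a) x≡y = cong (1 *_) (x≡y a)
  χ-*-cong (no _)  _   = refl

count≡sumMaps : ∀ v k {P : (Fin v → Fin k) → Set} (P? : ∀ f → Dec (P f)) →
  count v k P? ≡ sumMaps v k (χ ∘ P?)
count≡sumMaps zero    k P? = count-empty (P? (λ ()))
  where
  count-empty : ∀ {A} (d : Dec A) → count zero k {λ _ → A} (λ _ → d) ≡ χ d
  count-empty (yes _) = refl
  count-empty (no _)  = refl
count≡sumMaps (suc v) k P? =
  trans (sumFin≡sum k _) (sum-cong-≗ λ c → count≡sumMaps v k (P? ∘ (c ∷_)))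

select : ∀ {v k} {A : Set} → (Fin v → Fin k → A) → (Fin v → Fin k) → Fin v → A
select L i u = L u (i u)

select-cong : ∀ {v k} {A : Set} (L : Fin v → Fin k → A) {i j} → i ≗ j → select L i ≗ select L j
select-cong L i≗j u = cong (L u) (i≗j u)

module _ (G : Graph) where

  Proper-cong : ∀ {C : Set} {F F′ : Fin (size G) → C} → F ≗ F′ → Proper G F → Proper G F′
  Proper-cong F≗F′ F-proper u v uv Fu≡Fv =
    F-proper u v uv (trans (F≗F′ u) (trans Fu≡Fv (sym (F≗F′ v))))

  Proper-∘ : ∀ {A B : Set} {e : A → B} → Injective _≡_ _≡_ e → ∀ {f} → Proper G f → Proper G (e ∘ f)
  Proper-∘ e-inj f-proper u v uv = f-proper u v uv ∘ e-inj

  Proper-∘⁻¹ : ∀ {A B : Set} (e : A → B) {f : Fin (size G) → A} → Proper G (e ∘ f) → Proper G f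
  Proper-∘⁻¹ e ef-proper u v uv = ef-proper u v uv ∘ cong e

  χ-proper : (Fin (size G) → ℕ) → ℕ
  χ-proper F = χ (proper? G _≟_ F)

  χ-proper-cong : ∀ {F F′} → F ≗ F′ → χ-proper F ≡ χ-proper F′
  χ-proper-cong F≗F′ =
    χ-cong (mk⇔ (Proper-cong F≗F′) (Proper-cong (sym ∘ F≗F′))) (proper? G _≟_ _) (proper? G _≟_ _)

  χ-proper-relabel : ∀ {k} {ℓ ℓ′ : Fin k → ℕ} → Injective _≡_ _≡_ ℓ → Injective _≡_ _≡_ ℓ′ →
    ∀ f → χ-proper (ℓ ∘ f) ≡ χ-proper (ℓ′ ∘ f)
  χ-proper-relabel {ℓ = ℓ} {ℓ′} ℓ-inj ℓ′-inj f =
    χ-cong (mk⇔ (Proper-∘ ℓ′-inj ∘ Proper-∘⁻¹ ℓ) (Proper-∘ ℓ-inj ∘ Proper-∘⁻¹ ℓ′))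
           (proper? G _≟_ _) (proper? G _≟_ _)

PL≡sumMaps : ∀ G {k} (L : ListAssignment G k) →
  PL G L ≡ sumMaps (size G) k (χ-proper G ∘ select (proj₁ L))
PL≡sumMaps G {k} (L , _) = count≡sumMaps (size G) k _

P≡sumMaps : ∀ G k → P G k ≡ sumMaps (size G) k (λ i → χ-proper G (toℕ ∘ i))
P≡sumMaps G k = trans (count≡sumMaps (size G) k _) (sumMaps-cong (size G) λ i →
  χ-cong (mk⇔ (Proper-∘ G toℕ-injective) (Proper-∘⁻¹ G toℕ)) (proper? G Fin._≟_ i) (proper? G _≟_ _))

avoids? : ∀ {v} c (F : Fin v → ℕ) → Dec (∀ u → F u ≢ c)
avoids? c F = Fin.all? λ u → ¬? (F u ≟ c)

χ-avoids : ∀ {v} → ℕ → (Fin v → ℕ) → ℕ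
χ-avoids c F = χ (avoids? c F)

χ-avoidsAll : ∀ {v} → List ℕ → (Fin v → ℕ) → ℕ
χ-avoidsAll []       F = 1
χ-avoidsAll (c ∷ₗ cs) F = χ-avoids c F * χ-avoidsAll cs F

module _ {v : ℕ} where

  χ-avoids-cong : ∀ c {F F′ : Fin v → ℕ} → F ≗ F′ → χ-avoids c F ≡ χ-avoids c F′
  χ-avoids-cong c F≗F′ = χ-cong
    (mk⇔ (λ F-avoids u → F-avoids u ∘ trans (F≗F′ u)) (λ F′-avoids u → F′-avoids u ∘ trans (sym (F≗F′ u))))
    (avoids? c _) (avoids? c _)

  χ-avoidsAll-cong : ∀ cs {F F′ : Fin v → ℕ} → F ≗ F′ → χ-avoidsAll cs F ≡ χ-avoidsAll cs F′
  χ-avoidsAll-cong []       F≗F′ = refl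
  χ-avoidsAll-cong (c ∷ₗ cs) F≗F′ = cong₂ _*_ (χ-avoids-cong c F≗F′) (χ-avoidsAll-cong cs F≗F′)

  χ-avoidsAll-vacuous : ¬ Fin v → ∀ cs (F : Fin v → ℕ) → χ-avoidsAll cs F ≡ 1
  χ-avoidsAll-vacuous ¬v []       F = refl
  χ-avoidsAll-vacuous ¬v (c ∷ₗ cs) F =
    cong₂ _*_ (χ-yes (avoids? c F) (⊥-elim ∘ ¬v)) (χ-avoidsAll-vacuous ¬v cs F)

index-avoiding : ∀ {k} (ℓ : Fin (suc k) → ℕ) → Injective _≡_ _≡_ ℓ → ∀ c →
  ∃[ j ] ∀ j′ → ℓ (punchIn j j′) ≢ c
index-avoiding ℓ ℓ-inj c with Fin.any? (λ j → ℓ j ≟ c)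
... | yes (j , ℓj≡c) = j , λ j′ ℓj′≡c → Fin.punchInᵢ≢i j j′ (ℓ-inj (trans ℓj′≡c (sym ℓj≡c)))
... | no  c∉ℓ        = zero , λ j′ ℓj′≡c → c∉ℓ (_ , ℓj′≡c)

module _ (G : Graph) where
  open ≤-Reasoning

  χ-properAvoiding : List ℕ → (Fin (size G) → ℕ) → ℕ
  χ-properAvoiding cs F = χ-proper G F * χ-avoidsAll cs F

  χ-properAvoiding-∷ : ∀ c cs {F} → (∀ u → F u ≢ c) → χ-properAvoiding (c ∷ₗ cs) F ≡ χ-properAvoiding cs F
  χ-properAvoiding-∷ c cs {F} F-avoids =
    cong (χ-proper G F *_) (trans (cong (_* χ-avoidsAll cs F) (χ-yes (avoids? c F) F-avoids)) (*-identityˡ _))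

  χ-properAvoiding-hit : ∀ c cs {F} u → F u ≡ c → χ-properAvoiding (c ∷ₗ cs) F ≡ 0
  χ-properAvoiding-hit c cs {F} u Fu≡c =
    trans (cong (λ x → χ-proper G F * (x * χ-avoidsAll cs F)) (χ-no (avoids? c F) λ F-avoids → F-avoids u Fu≡c))
          (*-zeroʳ (χ-proper G F))

  PL-avoiding : ∀ {k} → (Fin (size G) → Fin k → ℕ) → List ℕ → ℕ
  PL-avoiding {k} L cs = sumMaps (size G) k (χ-properAvoiding cs ∘ select L)

  χ-properAvoiding-select-cong : ∀ {k} cs (L : Fin (size G) → Fin k → ℕ) →
    Congruent _≗_ _≡_ (χ-properAvoiding cs ∘ select L)
  χ-properAvoiding-select-cong cs L i≗j =
    cong₂ _*_ (χ-proper-cong G (select-cong L i≗j)) (χ-avoidsAll-cong cs (select-cong L i≗j))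

  PL≡PL-avoiding : ∀ {k} (L : ListAssignment G k) cs →
    (∀ i → χ-avoidsAll cs (select (proj₁ L) i) ≡ 1) → PL G L ≡ PL-avoiding (proj₁ L) cs
  PL≡PL-avoiding L cs avoids = trans (PL≡sumMaps G L) (sumMaps-cong (size G) λ i →
    sym (trans (cong (χ-proper G _ *_) (avoids i)) (*-identityʳ _)))

  PL-avoiding-≥ : ∀ cs {k m} (L : ListAssignment G k) →
    (∀ (L′ : ListAssignment G (k ∸ length cs)) → m ≤ PL G L′) → m ≤ PL-avoiding (proj₁ L) cs
  PL-avoiding-≥ [] L bound = ≤-trans (bound L) (≤-reflexive (PL≡PL-avoiding L [] λ _ → refl))
  PL-avoiding-≥ (c ∷ₗ cs) {zero} L bound = ≤-trans (bound L) (≤-reflexive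
    (PL≡PL-avoiding L (c ∷ₗ cs) λ i → χ-avoidsAll-vacuous (Fin.¬Fin0 ∘ i) (c ∷ₗ cs) _))
  PL-avoiding-≥ (c ∷ₗ cs) {suc k} {m} (L , L-inj) bound = begin
    m                          ≤⟨ PL-avoiding-≥ cs (L′ , L′-inj) bound ⟩
    PL-avoiding L′ cs        ≡⟨ sumMaps-cong (size G) (λ i → χ-properAvoiding-∷ c cs (L′-avoids i)) ⟨
    sumMaps (size G) k (χ-properAvoiding (c ∷ₗ cs) ∘ select L ∘ punchIns p)
                               ≤⟨ sumMaps-punchIns-≤ (size G) p _ (χ-properAvoiding-select-cong (c ∷ₗ cs) L) ⟩
    PL-avoiding L (c ∷ₗ cs)  ∎
    where
    p : Fin (size G) → Fin (suc k)
    p u = proj₁ (index-avoiding (L u) (L-inj u) c)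
    L′ : Fin (size G) → Fin k → ℕ
    L′ u = L u ∘ punchIn (p u)
    L′-inj : ∀ u → Injective _≡_ _≡_ (L′ u)
    L′-inj u = Fin.punchIn-injective (p u) _ _ ∘ L-inj u
    L′-avoids : ∀ i u → select L′ i u ≢ c
    L′-avoids i u = proj₂ (index-avoiding (L u) (L-inj u) c) (i u)

  PL-avoiding-≡ : ∀ cs {k} (ℓ : Fin k → ℕ) → Injective _≡_ _≡_ ℓ →
    All (λ c → ∃[ j ] ℓ j ≡ c) cs → Unique cs → PL-avoiding (λ _ → ℓ) cs ≡ P G (k ∸ length cs)
  PL-avoiding-≡ [] ℓ ℓ-inj _ _ = trans
    (sumMaps-cong (size G) λ i → trans (*-identityʳ _) (χ-proper-relabel G ℓ-inj toℕ-injective i))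
    (sym (P≡sumMaps G _))
  PL-avoiding-≡ (c ∷ₗ cs) {zero}  ℓ _ ((() , _) All.∷ _) _
  PL-avoiding-≡ (c ∷ₗ cs) {suc k} ℓ ℓ-inj ((j₀ , ℓj₀≡c) All.∷ cs⊆ℓ) (c∉cs AllPairs.∷ cs-unique) =
    begin-equality
    PL-avoiding (λ _ → ℓ) (c ∷ₗ cs)
      ≡⟨ sumMaps-punchIns (size G) (λ _ → j₀) _ (χ-properAvoiding-select-cong (c ∷ₗ cs) (λ _ → ℓ))
           (λ g u gu≡j₀ → χ-properAvoiding-hit c cs u (trans (cong ℓ gu≡j₀) ℓj₀≡c)) ⟨
    sumMaps (size G) k (χ-properAvoiding (c ∷ₗ cs) ∘ select (λ _ → ℓ) ∘ punchIns (λ _ → j₀))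
      ≡⟨ sumMaps-cong (size G) (λ i → χ-properAvoiding-∷ c cs (ℓ′-avoids ∘ i)) ⟩
    PL-avoiding (λ _ → ℓ′) cs
      ≡⟨ PL-avoiding-≡ cs ℓ′ ℓ′-inj (All.zipWith in-ℓ′ (cs⊆ℓ , c∉cs)) cs-unique ⟩
    P G (k ∸ length cs) ∎
    where
    ℓ′ : Fin k → ℕ
    ℓ′ = ℓ ∘ punchIn j₀
    ℓ′-inj : Injective _≡_ _≡_ ℓ′
    ℓ′-inj = Fin.punchIn-injective j₀ _ _ ∘ ℓ-inj
    ℓ′-avoids : ∀ j → ℓ′ j ≢ c
    ℓ′-avoids j ℓ′j≡c = Fin.punchInᵢ≢i j₀ j (ℓ-inj (trans ℓ′j≡c (sym ℓj₀≡c)))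
    in-ℓ′ : ∀ {c′} → (∃[ j ] ℓ j ≡ c′) × c ≢ c′ → ∃[ j ] ℓ′ j ≡ c′
    in-ℓ′ ((j , ℓj≡c′) , c≢c′) = punchOut j₀≢j , trans (cong ℓ (Fin.punchIn-punchOut j₀≢j)) ℓj≡c′
      where
      j₀≢j : j₀ ≢ j
      j₀≢j j₀≡j = c≢c′ (trans (sym ℓj₀≡c) (trans (cong ℓ j₀≡j) ℓj≡c′))

allAvoid? : ∀ {v n} (cs : Fin n → ℕ) (F : Fin v → ℕ) → Dec (∀ w → ∀ u → F u ≢ cs w)
allAvoid? cs F = Fin.all? λ w → avoids? (cs w) F

χ-avoidsAll-tabulate : ∀ {v n} (cs : Fin n → ℕ) (F : Fin v → ℕ) →
  χ-avoidsAll (tabulate cs) F ≡ χ (allAvoid? cs F)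
χ-avoidsAll-tabulate {n = zero}  cs F = sym (χ-yes (allAvoid? cs F) λ ())
χ-avoidsAll-tabulate {n = suc n} cs F = begin-equality
  χ-avoids (cs zero) F * χ-avoidsAll (tabulate (cs ∘ suc)) F
    ≡⟨ cong (χ-avoids (cs zero) F *_) (χ-avoidsAll-tabulate (cs ∘ suc) F) ⟩
  χ-avoids (cs zero) F * χ (allAvoid? (cs ∘ suc) F)
    ≡⟨ χ-×-dec (avoids? (cs zero) F) (allAvoid? (cs ∘ suc) F) ⟨
  χ (avoids? (cs zero) F ×-dec allAvoid? (cs ∘ suc) F)
    ≡⟨ χ-cong Fin.∀-cons-⇔ (avoids? (cs zero) F ×-dec allAvoid? (cs ∘ suc) F) (allAvoid? cs F) ⟩
  χ (allAvoid? cs F) ∎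
  where open ≤-Reasoning

module _ (G H : Graph) where
  private
    g = size G
    n = size H

  ∨-adj-ˡˡ : ∀ u v → adj (G ∨ H) (u ↑ˡ n) (v ↑ˡ n) ≡ adj G u v
  ∨-adj-ˡˡ u v rewrite Fin.splitAt-↑ˡ g u n | Fin.splitAt-↑ˡ g v n = refl

  ∨-adj-ʳʳ : ∀ u v → adj (G ∨ H) (g ↑ʳ u) (g ↑ʳ v) ≡ adj H u v
  ∨-adj-ʳʳ u v rewrite Fin.splitAt-↑ʳ g n u | Fin.splitAt-↑ʳ g n v = refl

  ∨-adj-ˡʳ : ∀ u v → adj (G ∨ H) (u ↑ˡ n) (g ↑ʳ v) ≡ true
  ∨-adj-ˡʳ u v rewrite Fin.splitAt-↑ˡ g u n | Fin.splitAt-↑ʳ g n v = refl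

  ∨-adj-ʳˡ : ∀ u v → adj (G ∨ H) (g ↑ʳ u) (v ↑ˡ n) ≡ true
  ∨-adj-ʳˡ u v rewrite Fin.splitAt-↑ʳ g n u | Fin.splitAt-↑ˡ g v n = refl

  ↑-view : ∀ x → (∃[ u ] u ↑ˡ n ≡ x) ⊎ (∃[ w ] g ↑ʳ w ≡ x)
  ↑-view x with splitAt g x in eq
  ... | inj₁ u = inj₁ (u , Fin.splitAt⁻¹-↑ˡ eq)
  ... | inj₂ w = inj₂ (w , Fin.splitAt⁻¹-↑ʳ eq)

  Proper-∨ : ∀ {C : Set} (f : Fin g → C) (h : Fin n → C) →
    Proper (G ∨ H) (f ++ h) ⇔ (Proper H h × Proper G f × (∀ w u → f u ≢ h w))
  Proper-∨ f h = mk⇔ to from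
    where
    to : Proper (G ∨ H) (f ++ h) → Proper H h × Proper G f × (∀ w u → f u ≢ h w)
    to p = (λ u v uv hu≡hv → p (g ↑ʳ u) (g ↑ʳ v) (trans (∨-adj-ʳʳ u v) uv)
                               (trans (lookup-++ʳ f h u) (trans hu≡hv (sym (lookup-++ʳ f h v)))))
         , (λ u v uv fu≡fv → p (u ↑ˡ n) (v ↑ˡ n) (trans (∨-adj-ˡˡ u v) uv)
                               (trans (lookup-++ˡ f h u) (trans fu≡fv (sym (lookup-++ˡ f h v)))))
         , (λ w u fu≡hw → p (u ↑ˡ n) (g ↑ʳ w) (∨-adj-ˡʳ u w)
                               (trans (lookup-++ˡ f h u) (trans fu≡hw (sym (lookup-++ʳ f h w)))))
    from : Proper H h × Proper G f × (∀ w u → f u ≢ h w) → Proper (G ∨ H) (f ++ h)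
    from (h-proper , f-proper , disjoint) x y xy eq with ↑-view x | ↑-view y
    ... | inj₁ (u , refl) | inj₁ (v , refl) = f-proper u v (trans (sym (∨-adj-ˡˡ u v)) xy)
                                                (trans (sym (lookup-++ˡ f h u)) (trans eq (lookup-++ˡ f h v)))
    ... | inj₂ (u , refl) | inj₂ (v , refl) = h-proper u v (trans (sym (∨-adj-ʳʳ u v)) xy)
                                                (trans (sym (lookup-++ʳ f h u)) (trans eq (lookup-++ʳ f h v)))
    ... | inj₁ (u , refl) | inj₂ (w , refl) = disjoint w u
                                                (trans (sym (lookup-++ˡ f h u)) (trans eq (lookup-++ʳ f h w)))
    ... | inj₂ (w , refl) | inj₁ (u , refl) = disjoint w u
                                                (sym (trans (sym (lookup-++ʳ f h w)) (trans eq (lookup-++ˡ f h u))))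

  χ-proper-∨ : ∀ (f : Fin g → ℕ) (h : Fin n → ℕ) →
    χ-proper (G ∨ H) (f ++ h) ≡ χ-proper H h * (χ-proper G f * χ-avoidsAll (tabulate h) f)
  χ-proper-∨ f h = begin-equality
    χ-proper (G ∨ H) (f ++ h)
      ≡⟨ χ-cong (Proper-∨ f h) (proper? (G ∨ H) _≟_ (f ++ h))
                (proper? H _≟_ h ×-dec (proper? G _≟_ f ×-dec allAvoid? h f)) ⟩
    χ (proper? H _≟_ h ×-dec (proper? G _≟_ f ×-dec allAvoid? h f))
      ≡⟨ χ-×-dec (proper? H _≟_ h) (proper? G _≟_ f ×-dec allAvoid? h f) ⟩
    χ-proper H h * χ (proper? G _≟_ f ×-dec allAvoid? h f)
      ≡⟨ cong (χ-proper H h *_) (χ-×-dec (proper? G _≟_ f) (allAvoid? h f)) ⟩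
    χ-proper H h * (χ-proper G f * χ (allAvoid? h f))
      ≡⟨ cong (λ x → χ-proper H h * (χ-proper G f * x)) (χ-avoidsAll-tabulate h f) ⟨
    χ-proper H h * (χ-proper G f * χ-avoidsAll (tabulate h) f) ∎
    where open ≤-Reasoning

  sumMaps-proper-∨ : ∀ {k} (L : Fin (g + n) → Fin k → ℕ) →
    let Lˡ = λ u → L (u ↑ˡ n); Lʳ = λ w → L (g ↑ʳ w) in
    sumMaps (g + n) k (χ-proper (G ∨ H) ∘ select L) ≡
    sumMaps n k (λ h → χ-proper H (select Lʳ h) * PL-avoiding G Lˡ (tabulate (select Lʳ h)))
  sumMaps-proper-∨ {k} L = begin-equality
    sumMaps (g + n) k (χ-proper (G ∨ H) ∘ select L)
      ≡⟨ sumMaps-++ g n _ (χ-proper-cong (G ∨ H) ∘ select-cong L) ⟩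
    sumMaps g k (λ f → sumMaps n k λ h → χ-proper (G ∨ H) (select L (f ++ h)))
      ≡⟨ sumMaps-cong g (λ f → sumMaps-cong n λ h →
           trans (χ-proper-cong (G ∨ H) (select-++ f h)) (χ-proper-∨ (select Lˡ f) (select Lʳ h))) ⟩
    sumMaps g k (λ f → sumMaps n k λ h → χ-proper H (select Lʳ h) * χ-properAvoiding G (cs h) (select Lˡ f))
      ≡⟨ sumMaps-comm g n _ ⟩
    sumMaps n k (λ h → sumMaps g k λ f → χ-proper H (select Lʳ h) * χ-properAvoiding G (cs h) (select Lˡ f))
      ≡⟨ sumMaps-cong n (λ h → *-distribˡ-sumMaps g (χ-proper H (select Lʳ h))
                                                     (χ-properAvoiding G (cs h) ∘ select Lˡ)) ⟨
    sumMaps n k (λ h → χ-proper H (select Lʳ h) * PL-avoiding G Lˡ (cs h)) ∎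
    where
    open ≤-Reasoning
    Lˡ = λ u → L (u ↑ˡ n)
    Lʳ = λ w → L (g ↑ʳ w)
    cs = λ h → tabulate (select Lʳ h)
    select-++ : ∀ f h → select L (f ++ h) ≗ select Lˡ f ++ select Lʳ h
    select-++ f h x with ↑-view x
    ... | inj₁ (u , refl) = trans (cong (L _) (lookup-++ˡ f h u)) (sym (lookup-++ˡ (select Lˡ f) (select Lʳ h) u))
    ... | inj₂ (w , refl) = trans (cong (L _) (lookup-++ʳ f h w)) (sym (lookup-++ʳ (select Lˡ f) (select Lʳ h) w))

K-adj : ∀ {n} (u v : Fin n) → u ≢ v → adj (K n) u v ≡ true
K-adj u v u≢v = cong not (dec-false (u Fin.≟ v) u≢v)

K-adj⁻¹ : ∀ {n} (u v : Fin n) → adj (K n) u v ≡ true → u ≢ v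
K-adj⁻¹ u v uv u≡v with trans (sym (cong not (dec-true (u Fin.≟ v) u≡v))) uv
... | ()

module _ {n : ℕ} where

  Proper-K⇒injective : ∀ {C : Set} {F : Fin n → C} → Proper (K n) F → Injective _≡_ _≡_ F
  Proper-K⇒injective F-proper {i} {j} Fi≡Fj with i Fin.≟ j
  ... | yes i≡j = i≡j
  ... | no  i≢j = ⊥-elim (F-proper i j (K-adj i j i≢j) Fi≡Fj)

  Proper-K-∷ : ∀ {C : Set} (x : C) (F : Fin n → C) →
    Proper (K (suc n)) (x ∷ F) ⇔ (Proper (K n) F × (∀ u → F u ≢ x))
  Proper-K-∷ x F = mk⇔ to from
    where
    to : Proper (K (suc n)) (x ∷ F) → Proper (K n) F × (∀ u → F u ≢ x)
    to p = (λ u v uv → p (suc u) (suc v) (K-adj {suc n} (suc u) (suc v) (K-adj⁻¹ {n} u v uv ∘ Fin.suc-injective)))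
         , (λ u → p (suc u) zero (K-adj {suc n} (suc u) zero λ ()))
    from : Proper (K n) F × (∀ u → F u ≢ x) → Proper (K (suc n)) (x ∷ F)
    from _                 zero    zero    uv = ⊥-elim (K-adj⁻¹ {suc n} zero zero uv refl)
    from (_ , F-avoids)    zero    (suc v) _  = F-avoids v ∘ sym
    from (_ , F-avoids)    (suc u) zero    _  = F-avoids u
    from (F-proper , _)    (suc u) (suc v) uv =
      F-proper u v (K-adj {n} u v (K-adj⁻¹ {suc n} (suc u) (suc v) uv ∘ cong suc))

  χ-proper-K-∷ : ∀ x (F : Fin n → ℕ) →
    χ-proper (K (suc n)) (x ∷ F) ≡ χ-proper (K n) F * χ-avoidsAll (x ∷ₗ []) F
  χ-proper-K-∷ x F = trans
    (χ-cong (Proper-K-∷ x F) (proper? (K (suc n)) _≟_ (x ∷ F)) (proper? (K n) _≟_ F ×-dec avoids? x F))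
    (trans (χ-×-dec (proper? (K n) _≟_ F) (avoids? x F)) (cong (χ-proper (K n) F *_) (sym (*-identityʳ _))))

  sumMaps-proper-K-suc : ∀ {k} (L : Fin (suc n) → Fin k → ℕ) →
    sumMaps (suc n) k (χ-proper (K (suc n)) ∘ select L) ≡ sum λ c → PL-avoiding (K n) (L ∘ suc) (L zero c ∷ₗ [])
  sumMaps-proper-K-suc L = sum-cong-≗ λ c → sumMaps-cong n λ h →
    trans (χ-proper-cong (K (suc n)) (∷-cong refl λ _ → refl)) (χ-proper-K-∷ (L zero c) (select (L ∘ suc) h))

P-K≤PL : ∀ n {k} (L : ListAssignment (K n) k) → P (K n) k ≤ PL (K n) L
P-K≤PL zero    {k} L = ≤-reflexive
  (trans (P≡sumMaps (K 0) k) (sym (PL≡sumMaps (K 0) L)))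
P-K≤PL (suc n) {k} (L , L-inj) = begin
  P (K (suc n)) k
    ≡⟨ P≡sumMaps (K (suc n)) k ⟩
  sumMaps (suc n) k (χ-proper (K (suc n)) ∘ select (λ _ → toℕ))
    ≡⟨ sumMaps-proper-K-suc {n} {k} (λ _ → toℕ) ⟩
  sum {k} (λ c → PL-avoiding (K n) (λ _ → toℕ) (toℕ c ∷ₗ []))
    ≡⟨ sum-cong-≗ {k} (λ c → PL-avoiding-≡ (K n) (toℕ c ∷ₗ []) toℕ toℕ-injective
                           ((c , refl) All.∷ All.[]) (All.[] AllPairs.∷ AllPairs.[])) ⟩
  sum {k} (λ c → P (K n) (k ∸ 1))
    ≤⟨ sum-mono-≤ {k} (λ c → PL-avoiding-≥ (K n) (L zero c ∷ₗ []) (L ∘ suc , L-inj ∘ suc) (P-K≤PL n)) ⟩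
  sum (λ c → PL-avoiding (K n) (L ∘ suc) (L zero c ∷ₗ []))
    ≡⟨ sumMaps-proper-K-suc {n} L ⟨
  sumMaps (suc n) k (χ-proper (K (suc n)) ∘ select L)
    ≡⟨ PL≡sumMaps (K (suc n)) (L , L-inj) ⟨
  PL (K (suc n)) (L , L-inj) ∎
  where open ≤-Reasoning

PL-∨-≥ : ∀ G H {k a b} →
  (∀ (L : ListAssignment G (k ∸ size H)) → a ≤ PL G L) → (∀ (L : ListAssignment H k) → b ≤ PL H L) →
  ∀ (L : ListAssignment (G ∨ H) k) → a * b ≤ PL (G ∨ H) L
PL-∨-≥ G H {k} {a} {b} G-bound H-bound (L , L-inj) = begin
  a * b
    ≤⟨ *-monoʳ-≤ a (H-bound (Lʳ , L-inj ∘ (g ↑ʳ_))) ⟩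
  a * PL H (Lʳ , L-inj ∘ (g ↑ʳ_))
    ≡⟨ cong (a *_) (PL≡sumMaps H (Lʳ , L-inj ∘ (g ↑ʳ_))) ⟩
  a * sumMaps n k (χ-proper H ∘ select Lʳ)
    ≡⟨ *-distribˡ-sumMaps n a (χ-proper H ∘ select Lʳ) ⟩
  sumMaps n k (λ h → a * χ-proper H (select Lʳ h))
    ≤⟨ sumMaps-mono-≤ n (λ h → ≤-trans (≤-reflexive (*-comm a (χ-proper H (select Lʳ h))))
                                        (*-monoʳ-≤ (χ-proper H (select Lʳ h)) (G-part h))) ⟩
  sumMaps n k (λ h → χ-proper H (select Lʳ h) * PL-avoiding G Lˡ (tabulate (select Lʳ h)))
    ≡⟨ sumMaps-proper-∨ G H L ⟨
  sumMaps (g + n) k (χ-proper (G ∨ H) ∘ select L)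
    ≡⟨ PL≡sumMaps (G ∨ H) (L , L-inj) ⟨
  PL (G ∨ H) (L , L-inj) ∎
  where
  open ≤-Reasoning
  g = size G
  n = size H
  Lˡ = λ u → L (u ↑ˡ n)
  Lʳ = λ w → L (g ↑ʳ w)
  G-part : ∀ h → a ≤ PL-avoiding G Lˡ (tabulate (select Lʳ h))
  G-part h = PL-avoiding-≥ G (tabulate (select Lʳ h)) (Lˡ , L-inj ∘ (_↑ˡ n))
    (subst (λ r → ∀ (L′ : ListAssignment G (k ∸ r)) → a ≤ PL G L′)
           (sym (length-tabulate (select Lʳ h))) G-bound)

P-∨-K : ∀ G n k → P (G ∨ K n) k ≡ P G (k ∸ n) * P (K n) k
P-∨-K G n k = begin-equality
  P (G ∨ K n) k
    ≡⟨ P≡sumMaps (G ∨ K n) k ⟩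
  sumMaps (size G + n) k (χ-proper (G ∨ K n) ∘ select (λ _ → toℕ))
    ≡⟨ sumMaps-proper-∨ G (K n) (λ _ → toℕ) ⟩
  sumMaps n k (λ h → χ-proper (K n) (toℕ ∘ h) * PL-avoiding G (λ _ → toℕ) (tabulate (toℕ ∘ h)))
    ≡⟨ sumMaps-cong n (λ h → χ-*-cong (proper? (K n) _≟_ (toℕ ∘ h)) (PL-avoiding-colours h)) ⟩
  sumMaps n k (λ h → χ-proper (K n) (toℕ ∘ h) * P G (k ∸ n))
    ≡⟨ sumMaps-cong n (λ h → *-comm (χ-proper (K n) (toℕ ∘ h)) _) ⟩
  sumMaps n k (λ h → P G (k ∸ n) * χ-proper (K n) (toℕ ∘ h))
    ≡⟨ *-distribˡ-sumMaps n (P G (k ∸ n)) (λ h → χ-proper (K n) (toℕ ∘ h)) ⟨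
  P G (k ∸ n) * sumMaps n k (λ h → χ-proper (K n) (toℕ ∘ h))
    ≡⟨ cong (P G (k ∸ n) *_) (P≡sumMaps (K n) k) ⟨
  P G (k ∸ n) * P (K n) k ∎
  where
  open ≤-Reasoning
  PL-avoiding-colours : ∀ (h : Fin n → Fin k) → Proper (K n) (toℕ ∘ h) →
    PL-avoiding G (λ _ → toℕ) (tabulate (toℕ ∘ h)) ≡ P G (k ∸ n)
  PL-avoiding-colours h h-proper = trans
    (PL-avoiding-≡ G (tabulate (toℕ ∘ h)) toℕ toℕ-injective
      (AllP.tabulate⁺ λ w → h w , refl) (UniqueP.tabulate⁺ (Proper-K⇒injective h-proper)))
    (cong (λ r → P G (k ∸ r)) (length-tabulate (toℕ ∘ h)))

PL-0≡P-0 : ∀ G (L : ListAssignment G 0) → PL G L ≡ P G 0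
PL-0≡P-0 G L = trans (PL≡sumMaps G L) (trans (sumMaps-cong (size G) λ i →
  χ-proper-cong G (⊥-elim ∘ Fin.¬Fin0 ∘ i)) (sym (P≡sumMaps G 0)))

toℕ-lists : ∀ G k → ListAssignment G k
toℕ-lists G k = (λ _ → toℕ) , λ _ → toℕ-injective

PL-toℕ : ∀ G k → PL G (toℕ-lists G k) ≡ P G k
PL-toℕ G k = trans (PL≡sumMaps G (toℕ-lists G k)) (sym (P≡sumMaps G k))

IsListColorFunction⇒≤P : ∀ G k {b} → IsListColorFunction G k b → b ≤ P G k
IsListColorFunction⇒≤P G k {b} (_ , b-min) = subst (b ≤_) (PL-toℕ G k) (b-min (toℕ-lists G k))

P≤PL⇒IsListColorFunction : ∀ G k → (∀ (L : ListAssignment G k) → P G k ≤ PL G L) →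
  IsListColorFunction G k (P G k)
P≤PL⇒IsListColorFunction G k P≤PL = (toℕ-lists G k , PL-toℕ G k) , P≤PL

Pℓ≡P⁺⇒P≤PL : ∀ G → (∀ m → 1 ≤ m → IsListColorFunction G m (P G m)) →
  ∀ m (L : ListAssignment G m) → P G m ≤ PL G L
Pℓ≡P⁺⇒P≤PL G Pℓ≡P zero    L = ≤-reflexive (sym (PL-0≡P-0 G L))
Pℓ≡P⁺⇒P≤PL G Pℓ≡P (suc m) L = proj₂ (Pℓ≡P (suc m) (s≤s z≤n)) L

proposition5p2 :
    ((G : Graph) (n k : ℕ) → 1 ≤ n → 1 ≤ k →
       ∀ (a b : ℕ) → IsListColorFunction G (k ∸ n) a → IsListColorFunction (G ∨ K n) k b →
       (a * P (K n) k ≤ b) × (b ≤ P (G ∨ K n) k) × (P (G ∨ K n) k ≡ P G (k ∸ n) * P (K n) k))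
    × ((G : Graph) (n : ℕ) → 1 ≤ n →
       (∀ (m : ℕ) → 1 ≤ m → IsListColorFunction G m (P G m)) →
       ∀ (k : ℕ) → 1 ≤ k → IsListColorFunction (G ∨ K n) k (P (G ∨ K n) k))
proposition5p2 =
  (λ G n k _ _ a b (_ , a-min) b-is@((L , PL≡b) , _) →
      subst (a * P (K n) k ≤_) PL≡b (PL-∨-≥ G (K n) a-min (P-K≤PL n) L)
    , IsListColorFunction⇒≤P (G ∨ K n) k b-is
    , P-∨-K G n k)
  , (λ G n _ Pℓ≡P k _ → P≤PL⇒IsListColorFunction (G ∨ K n) k λ L →
      subst (_≤ PL (G ∨ K n) L) (sym (P-∨-K G n k))
            (PL-∨-≥ G (K n) (Pℓ≡P⁺⇒P≤PL G Pℓ≡P (k ∸ n)) (P-K≤PL n) L))
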